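{- Let $p$ be a prime and $n\ge3$. Let $\sigma\in\mathrm{A}$ and let $b\in\mathrm{B}^\sigma$ be a $\sigma$-invariant element lying in the subgroup of $\mathrm{B}$ spanned by $\{\bar e_{i,i+2}\}_{i=0}^{n-2}$. Then $b$ lifts to a $\sigma$-invariant element of $\mathrm{U}^1/(\mathrm{conjugacy})$.
   Context: $\mathrm{U}$: upper unitriangular $(n+1)\times(n+1)$ matrices over $\mathbf{F}_p$, indices $0,\dots,n$; $e_{i,j}$ the matrix with $1$ at $(i,j)$ and other off-diagonal entries $0$; $\mathrm{U}^m$ the subgroup of matrices with vanishing entries at $(i,j)$ for $0<j-i\le m$; $\mathrm{A}=\mathrm{U}/\mathrm{U}^1$ with basis $\bar e_{i,i+1}$; $\mathrm{B}=\mathrm{U}^1/\mathrm{U}^3$ (abelianization of $\mathrm{U}^1$) with basis the images $\bar e_{i,j}$ of $e_{i,j}$, $2\le j-i\le 3$. $\mathrm{U}^1/(\mathrm{conjugacy})$ is the set of conjugacy classes of the group $\mathrm{U}^1$; conjugation by $\mathrm{U}$ induces actions of $\mathrm{A}$ on $\mathrm{U}^1/(\mathrm{conjugacy})$ and on $\mathrm{B}$ (the subgroup $\mathrm{U}^1$ acting trivially), compatible with the natural map $\mathrm{U}^1/(\mathrm{conjugacy})\to\mathrm{B}$. "Lifts" means maps to $b$ under this map. Superscript $\sigma$ denotes $\sigma$-fixed elements. -}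

module Defs where

open import Data.Nat as ℕ using (ℕ; zero; suc)
open import Data.Integer using (ℤ; +_; _+_; _*_; _-_)
open import Data.Integer.Divisibility using (_∣_)
open import Data.Fin using (Fin; toℕ) renaming (zero to fz; suc to fs)
open import Data.Product using (Σ; _×_; ∃)
open import Relation.Binary.PropositionalEquality using () renaming (_≡_ to _≡ℕ_)

-- Arithmetic of F_p, modelled as ℤ modulo the congruence "p divides the difference".
_≡_[mod_] : ℤ → ℤ → ℕ → Set
a ≡ b [mod p ] = (+ p) ∣ (a - b)

sumFin : ∀ m → (Fin m → ℤ) → ℤ
sumFin zero    f = + 0
sumFin (suc m) f = f fz + sumFin m (λ i → f (fs i))

-- (n+1)×(n+1) matrices with integer entries (indices 0,…,n), read mod p.
Mat : ℕ → Set
Mat n = Fin (suc n) → Fin (suc n) → ℤ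

_⊗_ : ∀ {n} → Mat n → Mat n → Mat n
_⊗_ {n} x y i j = sumFin (suc n) (λ k → x i k * y k j)

MatEq : ℕ → ∀ n → Mat n → Mat n → Set
MatEq p n x y = ∀ i j → x i j ≡ y i j [mod p ]

InU : ℕ → ∀ n → Mat n → Set
InU p n x = (∀ i → x i i ≡ + 1 [mod p ])
          × (∀ i j → toℕ j ℕ.< toℕ i → x i j ≡ + 0 [mod p ])

InUm : ℕ → ∀ n → ℕ → Mat n → Set
InUm p n m x = InU p n x
             × (∀ i j → toℕ i ℕ.< toℕ j → toℕ j ℕ.≤ toℕ i ℕ.+ m → x i j ≡ + 0 [mod p ])

-- Elements of B = U^1/U^3 are given by their coordinates at (i,j), 2 ≤ j - i ≤ 3
-- (w.r.t. the basis ē_{i,j}); we store them as a matrix of which only these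
-- entries matter.  BEq: equality in B.
BEq : ℕ → ∀ n → Mat n → Mat n → Set
BEq p n b c = ∀ i j → toℕ i ℕ.+ 2 ℕ.≤ toℕ j → toℕ j ℕ.≤ toℕ i ℕ.+ 3 → b i j ≡ c i j [mod p ]

Lifts : ℕ → ∀ n → Mat n → Mat n → Set
Lifts p n x b = InUm p n 1 x × BEq p n x b

-- b lies in the span of the ē_{i,i+2}: its ē_{i,i+3}-coordinates vanish.
InSpan2 : ℕ → ∀ n → Mat n → Set
InSpan2 p n b = ∀ i j → toℕ j ≡ℕ toℕ i ℕ.+ 3 → b i j ≡ + 0 [mod p ]

-- Conjugation by g: y = g x g⁻¹, expressed without inverses as g x = y g.
ConjBy : ℕ → ∀ n → Mat n → Mat n → Mat n → Set
ConjBy p n g x y = MatEq p n (g ⊗ x) (y ⊗ g)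

ConjInU1 : ℕ → ∀ n → Mat n → Mat n → Set
ConjInU1 p n x y = Σ (Mat n) λ h → InUm p n 1 h × ConjBy p n h x y

-- σ ∈ A is represented by any g ∈ U with image σ in A = U/U^1; the action of σ
-- on B sends the image of x ∈ U^1 to the image of g x g⁻¹.
-- b ∈ B is σ-invariant:
BFixed : ℕ → ∀ n → Mat n → Mat n → Set
BFixed p n g b = Σ (Mat n) λ x → Σ (Mat n) λ y →
  Lifts p n x b × ConjBy p n g x y × BEq p n y b

-- The conjugacy class of x ∈ U^1 is σ-invariant: g x g⁻¹ is U^1-conjugate to x.
ClassFixed : ℕ → ∀ n → Mat n → Mat n → Set
ClassFixed p n g x = Σ (Mat n) λ y → ConjBy p n g x y × ConjInU1 p n y x

{-# OPTIONS --safe #-}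
module Submission where

open import Defs
open import Algebra.Bundles using (Ring; CommutativeMonoid)
import Algebra.Construct.Pointwise as Pointwise
import Algebra.Properties.AbelianGroup as AbelianGroupProperties
open import Data.Bool using (if_then_else_)
open import Data.Empty using (⊥-elim)
open import Data.Fin using (Fin; toℕ; fromℕ<; _≟_) renaming (zero to fz; suc to fs)
open import Data.Fin.Properties using (punchInᵢ≢i; toℕ<n; toℕ-fromℕ<; toℕ-injective)
open import Data.Integer as Int using (ℤ; +_)
import Data.Integer.Properties as ℤₚ
import Data.Integer.Divisibility.Signed as Signed
open import Data.Integer.Solver using (module +-*-Solver)
open import Data.Nat as ℕ using (ℕ; zero; suc; _<_; _≤_)
import Data.Nat.Properties as ℕₚ
open import Data.Nat.Primality using (Prime)
open import Data.Product using (Σ; _×_; _,_; proj₁; proj₂)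
open import Data.Vec.Functional using (Vector; removeAt; foldr)
open import Level using (0ℓ)
open import Relation.Binary.Core using (Rel)
open import Relation.Binary.Definitions using (tri<; tri≈; tri>)
open import Relation.Binary.PropositionalEquality as ≡ using (_≡_; _≢_)
import Relation.Binary.Reasoning.Setoid as SetoidReasoning
open import Relation.Nullary using (yes; no)
open import Relation.Nullary.Decidable using (does; dec-true; dec-false)

-- A σ-invariant b is the common image in B of some x₀ ∈ U¹ and of y₀ = g x₀ g⁻¹. Writing g = 1 + M and comparing
-- the entries (i, i+3) of g x₀ = y₀ g gives g_{i,i+1} b_{i+1,i+3} = b_{i,i+2} g_{i+2,i+3}, i.e. the first
-- superdiagonal D of M commutes with N = Σ b_{i,i+2} e_{i,i+2}. So x = 1 + N lifts b and commutes with k = 1 + D;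
-- since k and g agree up to the first superdiagonal, h = k g⁻¹ lies in U¹, and it conjugates g x g⁻¹ back to x.
-- The inverse g⁻¹ is the finite geometric series in the nilpotent 1 - g.

module IntegersModulo (p : ℕ) where

  open Int using (_+_; _*_; _-_; -_)
  open Signed using (∣ᵤ⇒∣; ∣⇒∣ᵤ) renaming (_∣_ to _∣ₛ_)
  open +-*-Solver

  -- Integers are passed explicitly throughout: a ≡ b [mod p ] does not determine a and b.
  private
    infix 4 _≈_
    _≈_ : ℤ → ℤ → Set
    a ≈ b = a ≡ b [mod p ]

    ≈-via : ∀ a b {d} → a - b ≡ d → + p ∣ₛ d → a ≈ b
    ≈-via a b a-b≡d p∣d = ∣⇒∣ᵤ (≡.subst (+ p ∣ₛ_) (≡.sym a-b≡d) p∣d)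

    ∣-diff : ∀ a b → a ≈ b → + p ∣ₛ (a - b)
    ∣-diff a b = ∣ᵤ⇒∣

  ≡⇒≡[mod] : ∀ {a b} → a ≡ b → a ≡ b [mod p ]
  ≡⇒≡[mod] {a} ≡.refl = ≈-via a a (ℤₚ.+-inverseʳ a) (Signed.divides (+ 0) ≡.refl)

  ≡[mod]-sym : ∀ a b → a ≈ b → b ≈ a
  ≡[mod]-sym a b a≈b =
    ≈-via b a (solve 2 (λ a b → b :- a := :- (a :- b)) ≡.refl a b) (Signed.∣m⇒∣-m (∣-diff a b a≈b))

  ≡[mod]-trans : ∀ a b c → a ≈ b → b ≈ c → a ≈ c
  ≡[mod]-trans a b c a≈b b≈c =
    ≈-via a c (solve 3 (λ a b c → a :- c := (a :- b) :+ (b :- c)) ≡.refl a b c)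
          (Signed.∣m∣n⇒∣m+n (∣-diff a b a≈b) (∣-diff b c b≈c))

  +-cong[mod] : ∀ a b c d → a ≈ b → c ≈ d → a + c ≈ b + d
  +-cong[mod] a b c d a≈b c≈d =
    ≈-via (a + c) (b + d) (solve 4 (λ a b c d → (a :+ c) :- (b :+ d) := (a :- b) :+ (c :- d)) ≡.refl a b c d)
          (Signed.∣m∣n⇒∣m+n (∣-diff a b a≈b) (∣-diff c d c≈d))

  *-cong[mod] : ∀ a b c d → a ≈ b → c ≈ d → a * c ≈ b * d
  *-cong[mod] a b c d a≈b c≈d =
    ≈-via (a * c) (b * d) (solve 4 (λ a b c d → (a :* c) :- (b :* d) := (a :- b) :* c :+ b :* (c :- d)) ≡.refl a b c d)
          (Signed.∣m∣n⇒∣m+n (Signed.∣m⇒∣m*n c (∣-diff a b a≈b)) (Signed.∣n⇒∣m*n b (∣-diff c d c≈d)))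

  -‿cong[mod] : ∀ a b → a ≈ b → - a ≈ - b
  -‿cong[mod] a b a≈b =
    ≈-via (- a) (- b) (solve 2 (λ a b → (:- a) :- (:- b) := :- (a :- b)) ≡.refl a b) (Signed.∣m⇒∣-m (∣-diff a b a≈b))

  ring : Ring 0ℓ 0ℓ
  ring = record
    { Carrier = ℤ
    ; _≈_     = _≡_[mod p ]
    ; _+_     = _+_
    ; _*_     = _*_
    ; -_      = -_
    ; 0#      = + 0
    ; 1#      = + 1
    ; isRing  = record
      { +-isAbelianGroup = record
        { isGroup = record
          { isMonoid = record
            { isSemigroup = record
              { isMagma = record
                { isEquivalence = record
                  { refl  = λ {a} → ≡⇒≡[mod] {a} ≡.refl
                  ; sym   = λ {a} {b} → ≡[mod]-sym a b
                  ; trans = λ {a} {b} {c} → ≡[mod]-trans a b c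
                  }
                ; ∙-cong = λ {a} {b} {c} {d} → +-cong[mod] a b c d
                }
              ; assoc   = λ a b c → ≡⇒≡[mod] (ℤₚ.+-assoc a b c)
              }
            ; identity = (λ a → ≡⇒≡[mod] (ℤₚ.+-identityˡ a)) , (λ a → ≡⇒≡[mod] (ℤₚ.+-identityʳ a))
            }
          ; inverse = (λ a → ≡⇒≡[mod] (ℤₚ.+-inverseˡ a)) , (λ a → ≡⇒≡[mod] (ℤₚ.+-inverseʳ a))
          ; ⁻¹-cong = λ {a} {b} → -‿cong[mod] a b
          }
        ; comm = λ a b → ≡⇒≡[mod] (ℤₚ.+-comm a b)
        }
      ; *-cong     = λ {a} {b} {c} {d} → *-cong[mod] a b c d
      ; *-assoc    = λ a b c → ≡⇒≡[mod] (ℤₚ.*-assoc a b c)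
      ; *-identity = (λ a → ≡⇒≡[mod] (ℤₚ.*-identityˡ a)) , (λ a → ≡⇒≡[mod] (ℤₚ.*-identityʳ a))
      ; distrib    = (λ a b c → ≡⇒≡[mod] (ℤₚ.*-distribˡ-+ a b c)) , (λ a b c → ≡⇒≡[mod] (ℤₚ.*-distribʳ-+ a b c))
      }
    }

ℤ/_ : ℕ → Ring 0ℓ 0ℓ
ℤ/ p = IntegersModulo.ring p

module GeometricSeries {c ℓ} (R : Ring c ℓ) where

  open Ring R
  open import Algebra.Properties.Semiring.Exp semiring using (_^_)
  open import Algebra.Properties.Ring R using (x[y-z]≈xy-xz; [y-z]x≈yx-zx)
  open import Algebra.Properties.AbelianGroup +-abelianGroup using (ε⁻¹≈ε)
  open import Relation.Binary.Reasoning.Setoid setoid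

  geometricSum : Carrier → ℕ → Carrier
  geometricSum q zero    = 0#
  geometricSum q (suc k) = 1# + q * geometricSum q k

  private
    telescope : ∀ a b d → (a - b) + (b - d) ≈ a - d
    telescope a b d = begin
      (a - b) + (b - d)     ≈⟨ +-assoc a (- b) (b - d) ⟩
      a + (- b + (b - d))   ≈⟨ +-congˡ (+-assoc (- b) b (- d)) ⟨
      a + ((- b + b) - d)   ≈⟨ +-congˡ (+-congʳ (-‿inverseˡ b)) ⟩
      a + (0# - d)          ≈⟨ +-congˡ (+-identityˡ (- d)) ⟩
      a - d                 ∎

    step : ∀ q k → (1# - q) + q * (1# - q ^ k) ≈ 1# - q ^ suc k
    step q k = begin
      (1# - q) + q * (1# - q ^ k)      ≈⟨ +-congˡ (x[y-z]≈xy-xz q 1# (q ^ k)) ⟩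
      (1# - q) + (q * 1# - q ^ suc k)  ≈⟨ +-congˡ (+-congʳ (*-identityʳ q)) ⟩
      (1# - q) + (q - q ^ suc k)       ≈⟨ telescope 1# q (q ^ suc k) ⟩
      1# - q ^ suc k                   ∎

    1-q-comm : ∀ q → (1# - q) * q ≈ q * (1# - q)
    1-q-comm q = begin
      (1# - q) * q     ≈⟨ [y-z]x≈yx-zx q 1# q ⟩
      1# * q - q * q   ≈⟨ +-congʳ (trans (*-identityˡ q) (sym (*-identityʳ q))) ⟩
      q * 1# - q * q   ≈⟨ x[y-z]≈xy-xz q 1# q ⟨
      q * (1# - q)     ∎

    1-1≈0 : 1# - 1# ≈ 0#
    1-1≈0 = -‿inverseʳ 1#

  [1-q]*geometricSum : ∀ q k → (1# - q) * geometricSum q k ≈ 1# - q ^ k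
  [1-q]*geometricSum q zero = trans (zeroʳ (1# - q)) (sym 1-1≈0)
  [1-q]*geometricSum q (suc k) = begin
    (1# - q) * (1# + q * S)            ≈⟨ distribˡ (1# - q) 1# (q * S) ⟩
    (1# - q) * 1# + (1# - q) * (q * S) ≈⟨ +-cong (*-identityʳ (1# - q)) (sym (*-assoc (1# - q) q S)) ⟩
    (1# - q) + ((1# - q) * q) * S      ≈⟨ +-congˡ (*-congʳ (1-q-comm q)) ⟩
    (1# - q) + (q * (1# - q)) * S      ≈⟨ +-congˡ (*-assoc q (1# - q) S) ⟩
    (1# - q) + q * ((1# - q) * S)      ≈⟨ +-congˡ (*-congˡ ([1-q]*geometricSum q k)) ⟩
    (1# - q) + q * (1# - q ^ k)        ≈⟨ step q k ⟩
    1# - q ^ suc k                     ∎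
    where S = geometricSum q k

  geometricSum*[1-q] : ∀ q k → geometricSum q k * (1# - q) ≈ 1# - q ^ k
  geometricSum*[1-q] q zero = trans (zeroˡ (1# - q)) (sym 1-1≈0)
  geometricSum*[1-q] q (suc k) = begin
    (1# + q * S) * (1# - q)            ≈⟨ distribʳ (1# - q) 1# (q * S) ⟩
    1# * (1# - q) + (q * S) * (1# - q) ≈⟨ +-cong (*-identityˡ (1# - q)) (*-assoc q S (1# - q)) ⟩
    (1# - q) + q * (S * (1# - q))      ≈⟨ +-congˡ (*-congˡ (geometricSum*[1-q] q k)) ⟩
    (1# - q) + q * (1# - q ^ k)        ≈⟨ step q k ⟩
    1# - q ^ suc k                     ∎
    where S = geometricSum q k

  nilpotent⇒1-q-invertible : ∀ q k → q ^ k ≈ 0# →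
    (1# - q) * geometricSum q k ≈ 1# × geometricSum q k * (1# - q) ≈ 1#
  nilpotent⇒1-q-invertible q k q^k≈0 =
    trans ([1-q]*geometricSum q k) 1-q^k≈1 , trans (geometricSum*[1-q] q k) 1-q^k≈1
    where
    1-q^k≈1 : 1# - q ^ k ≈ 1#
    1-q^k≈1 = trans (+-congˡ (trans (-‿cong q^k≈0) ε⁻¹≈ε)) (+-identityʳ 1#)

module Commutation {c ℓ} (R : Ring c ℓ) where

  open Ring R
  open import Relation.Binary.Reasoning.Setoid setoid

  1+-commute : ∀ {a b} → a * b ≈ b * a → (1# + a) * b ≈ b * (1# + a)
  1+-commute {a} {b} ab≈ba = begin
    (1# + a) * b    ≈⟨ distribʳ b 1# a ⟩
    1# * b + a * b  ≈⟨ +-cong (trans (*-identityˡ b) (sym (*-identityʳ b))) ab≈ba ⟩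
    b * 1# + b * a  ≈⟨ distribˡ b 1# a ⟨
    b * (1# + a)    ∎

module FiniteSums {c ℓ} (M : CommutativeMonoid c ℓ) where

  open CommutativeMonoid M
  open import Algebra.Properties.CommutativeMonoid.Sum M using (sum; sum-cong-≋; sum-replicate-zero; sum-remove)
  open import Relation.Binary.Reasoning.Setoid setoid

  sum-≈ε : ∀ {n} (t : Vector Carrier n) → (∀ k → t k ≈ ε) → sum t ≈ ε
  sum-≈ε {n} t t≈ε = trans (sum-cong-≋ t≈ε) (sum-replicate-zero n)

  sum-single : ∀ {n} (t : Vector Carrier n) i → (∀ k → k ≢ i → t k ≈ ε) → sum t ≈ t i
  sum-single {suc n} t i t≈ε = begin
    sum t                     ≈⟨ sum-remove t ⟩
    t i ∙ sum (removeAt t i)  ≈⟨ ∙-congˡ (sum-≈ε (removeAt t i) (λ k → t≈ε _ (punchInᵢ≢i i k))) ⟩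
    t i ∙ ε                   ≈⟨ identityʳ (t i) ⟩
    t i                       ∎

module Matrices {c ℓ} (R : Ring c ℓ) (m : ℕ) where

  open Ring R
  open import Algebra.Properties.Semiring.Sum semiring
    using (sum; sum-cong-≋; ∑-comm; ∑-distrib-+; *-distribˡ-sum; *-distribʳ-sum)
  open FiniteSums +-commutativeMonoid using (sum-≈ε; sum-single)
  open AbelianGroupProperties +-abelianGroup using (ε⁻¹≈ε; x≈y⇒x∙y⁻¹≈ε; x∙y⁻¹≈ε⇒x≈y)
  open import Relation.Binary.Reasoning.Setoid setoid

  Matrix : Set c
  Matrix = Fin m → Fin m → Carrier

  infix  4 _≋_
  infixl 7 _*ᴹ_
  infixl 6 _+ᴹ_ _-ᴹ_
  infix  8 -ᴹ_

  _≋_ : Rel Matrix ℓ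
  A ≋ B = ∀ i j → A i j ≈ B i j

  0ᴹ 1ᴹ : Matrix
  0ᴹ i j = 0#
  1ᴹ i j = if does (i ≟ j) then 1# else 0#

  _+ᴹ_ _-ᴹ_ _*ᴹ_ : Matrix → Matrix → Matrix
  (A +ᴹ B) i j = A i j + B i j
  (A -ᴹ B) i j = A i j - B i j
  (A *ᴹ B) i j = sum λ k → A i k * B k j

  -ᴹ_ : Matrix → Matrix
  (-ᴹ A) i j = - A i j

  1ᴹ-diagonal : ∀ i → 1ᴹ i i ≡ 1#
  1ᴹ-diagonal i rewrite dec-true (i ≟ i) ≡.refl = ≡.refl

  1ᴹ-off-diagonal : ∀ i j → i ≢ j → 1ᴹ i j ≡ 0#
  1ᴹ-off-diagonal i j i≢j rewrite dec-false (i ≟ j) i≢j = ≡.refl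

  private
    *ᴹ-assoc : ∀ A B C → (A *ᴹ B) *ᴹ C ≋ A *ᴹ (B *ᴹ C)
    *ᴹ-assoc A B C i j = begin
      (sum λ k → (sum λ l → A i l * B l k) * C k j)    ≈⟨ sum-cong-≋ (λ k → *-distribʳ-sum (C k j) (λ l → A i l * B l k)) ⟩
      (sum λ k → sum λ l → (A i l * B l k) * C k j)    ≈⟨ ∑-comm (λ k l → (A i l * B l k) * C k j) ⟩
      (sum λ l → sum λ k → (A i l * B l k) * C k j)    ≈⟨ sum-cong-≋ (λ l → sum-cong-≋ (λ k → *-assoc (A i l) (B l k) (C k j))) ⟩
      (sum λ l → sum λ k → A i l * (B l k * C k j))    ≈⟨ sum-cong-≋ (λ l → *-distribˡ-sum (A i l) (λ k → B l k * C k j)) ⟨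
      (sum λ l → A i l * (sum λ k → B l k * C k j))    ∎

    *ᴹ-identityˡ : ∀ A → 1ᴹ *ᴹ A ≋ A
    *ᴹ-identityˡ A i j = trans (sum-single _ i off) (trans (*-congʳ (reflexive (1ᴹ-diagonal i))) (*-identityˡ (A i j)))
      where
      off : ∀ k → k ≢ i → 1ᴹ i k * A k j ≈ 0#
      off k k≢i = trans (*-congʳ (reflexive (1ᴹ-off-diagonal i k (λ i≡k → k≢i (≡.sym i≡k))))) (zeroˡ (A k j))

    *ᴹ-identityʳ : ∀ A → A *ᴹ 1ᴹ ≋ A
    *ᴹ-identityʳ A i j = trans (sum-single _ j off) (trans (*-congˡ (reflexive (1ᴹ-diagonal j))) (*-identityʳ (A i j)))
      where
      off : ∀ k → k ≢ j → A i k * 1ᴹ k j ≈ 0#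
      off k k≢j = trans (*-congˡ (reflexive (1ᴹ-off-diagonal k j k≢j))) (zeroʳ (A i k))

    *ᴹ-distribˡ : ∀ A B C → A *ᴹ (B +ᴹ C) ≋ A *ᴹ B +ᴹ A *ᴹ C
    *ᴹ-distribˡ A B C i j =
      trans (sum-cong-≋ (λ k → distribˡ (A i k) (B k j) (C k j))) (∑-distrib-+ (λ k → A i k * B k j) (λ k → A i k * C k j))

    *ᴹ-distribʳ : ∀ C A B → (A +ᴹ B) *ᴹ C ≋ A *ᴹ C +ᴹ B *ᴹ C
    *ᴹ-distribʳ C A B i j =
      trans (sum-cong-≋ (λ k → distribʳ (C k j) (A i k) (B i k))) (∑-distrib-+ (λ k → A i k * C k j) (λ k → B i k * C k j))

  matrixRing : Ring c ℓ
  matrixRing = record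
    { Carrier = Matrix
    ; _≈_     = _≋_
    ; _+_     = _+ᴹ_
    ; _*_     = _*ᴹ_
    ; -_      = -ᴹ_
    ; 0#      = 0ᴹ
    ; 1#      = 1ᴹ
    ; isRing  = record
      { +-isAbelianGroup = Pointwise.isAbelianGroup (Fin m) (Pointwise.isAbelianGroup (Fin m) +-isAbelianGroup)
      ; *-cong     = λ A≋A′ B≋B′ i j → sum-cong-≋ (λ k → *-cong (A≋A′ i k) (B≋B′ k j))
      ; *-assoc    = *ᴹ-assoc
      ; *-identity = *ᴹ-identityˡ , *ᴹ-identityʳ
      ; distrib    = *ᴹ-distribˡ , *ᴹ-distribʳ
      }
    }

  module 𝕄 = Ring matrixRing
  open import Algebra.Properties.Semiring.Exp 𝕄.semiring using (_^_)

  Upper : ℕ → Matrix → Set ℓ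
  Upper s A = ∀ i j → toℕ j < toℕ i ℕ.+ s → A i j ≈ 0#

  upper-resp : ∀ {s A B} → A ≋ B → Upper s A → Upper s B
  upper-resp A≋B upper i j j<i+s = trans (sym (A≋B i j)) (upper i j j<i+s)

  upper-weaken : ∀ {s t A} → t ≤ s → Upper s A → Upper t A
  upper-weaken t≤s upper i j j<i+t = upper i j (ℕₚ.<-≤-trans j<i+t (ℕₚ.+-monoʳ-≤ (toℕ i) t≤s))

  upper-0ᴹ : ∀ {s} → Upper s 0ᴹ
  upper-0ᴹ i j _ = refl

  upper-1ᴹ : Upper 0 1ᴹ
  upper-1ᴹ i j j<i+0 = reflexive (1ᴹ-off-diagonal i j (λ { ≡.refl → ℕₚ.<-irrefl (≡.sym (ℕₚ.+-identityʳ (toℕ i))) j<i+0 }))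

  upper-+ᴹ : ∀ {s A B} → Upper s A → Upper s B → Upper s (A +ᴹ B)
  upper-+ᴹ uA uB i j j<i+s = trans (+-cong (uA i j j<i+s) (uB i j j<i+s)) (+-identityʳ 0#)

  upper--ᴹ : ∀ {s A} → Upper s A → Upper s (-ᴹ A)
  upper--ᴹ uA i j j<i+s = trans (-‿cong (uA i j j<i+s)) ε⁻¹≈ε

  private
    *ᴹ-term≈0 : ∀ {s t A B} → Upper s A → Upper t B → ∀ i j k →
                (toℕ i ℕ.+ s ≤ toℕ k → toℕ j < toℕ k ℕ.+ t) → A i k * B k j ≈ 0#
    *ᴹ-term≈0 {s} {A = A} {B} uA uB i j k far with toℕ k ℕ.<? toℕ i ℕ.+ s
    ... | yes k<i+s = trans (*-congʳ (uA i k k<i+s)) (zeroˡ (B k j))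
    ... | no  k≮i+s = trans (*-congˡ (uB k j (far (ℕₚ.≮⇒≥ k≮i+s)))) (zeroʳ (A i k))

  upper-*ᴹ : ∀ {s t A B} → Upper s A → Upper t B → Upper (s ℕ.+ t) (A *ᴹ B)
  upper-*ᴹ {s} {t} uA uB i j j<i+s+t = sum-≈ε _ λ k → *ᴹ-term≈0 uA uB i j k λ i+s≤k →
    ℕₚ.<-≤-trans j<i+s+t (ℕₚ.≤-trans (ℕₚ.≤-reflexive (≡.sym (ℕₚ.+-assoc (toℕ i) s t))) (ℕₚ.+-monoˡ-≤ t i+s≤k))

  upper-^ : ∀ {s A} → Upper s A → ∀ k → Upper (k ℕ.* s) (A ^ k)
  upper-^ uA zero    = upper-1ᴹ
  upper-^ uA (suc k) = upper-*ᴹ uA (upper-^ uA k)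

  upper-size⇒≋0ᴹ : ∀ {A} → Upper m A → A ≋ 0ᴹ
  upper-size⇒≋0ᴹ uA i j = uA i j (ℕₚ.<-≤-trans (toℕ<n j) (ℕₚ.m≤n+m m (toℕ i)))

  *ᴹ-entry : ∀ {s t A B} → Upper s A → Upper t B →
             ∀ {i l j} → toℕ l ≡ toℕ i ℕ.+ s → toℕ j ≡ toℕ l ℕ.+ t → (A *ᴹ B) i j ≈ A i l * B l j
  *ᴹ-entry {s} {t} uA uB {i} {l} {j} l≡i+s j≡l+t = sum-single _ l λ k k≢l → *ᴹ-term≈0 uA uB i j k λ i+s≤k →
    ℕₚ.≤-<-trans (ℕₚ.≤-reflexive j≡l+t)
      (ℕₚ.+-monoˡ-< t (ℕₚ.≤∧≢⇒< (ℕₚ.≤-trans (ℕₚ.≤-reflexive l≡i+s) i+s≤k) (λ l≡k → k≢l (toℕ-injective (≡.sym l≡k)))))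

  module UnitriangularInverse (g : Matrix) (g-unitriangular : Upper 1 (g -ᴹ 1ᴹ)) where

    open GeometricSeries matrixRing
    open AbelianGroupProperties 𝕄.+-abelianGroup using (⁻¹-anti-homo‿-; //-rightDividesˡ)

    private
      q : Matrix
      q = 1ᴹ -ᴹ g

      upper-q : Upper 1 q
      upper-q = upper-resp (⁻¹-anti-homo‿- g 1ᴹ) (upper--ᴹ g-unitriangular)

      1-q≋g : 1ᴹ -ᴹ q ≋ g
      1-q≋g = 𝕄.trans (𝕄.+-congˡ (⁻¹-anti-homo‿- 1ᴹ g)) (𝕄.trans (𝕄.+-comm 1ᴹ (g -ᴹ 1ᴹ)) (//-rightDividesˡ 1ᴹ g))

      q-nilpotent : q ^ m ≋ 0ᴹ
      q-nilpotent = upper-size⇒≋0ᴹ (upper-weaken (ℕₚ.≤-reflexive (≡.sym (ℕₚ.*-identityʳ m))) (upper-^ upper-q m))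

      upper-geometricSum : ∀ k → Upper 0 (geometricSum q k)
      upper-geometricSum zero    = upper-0ᴹ
      upper-geometricSum (suc k) = upper-+ᴹ upper-1ᴹ (upper-weaken ℕ.z≤n (upper-*ᴹ upper-q (upper-geometricSum k)))

    g⁻¹ : Matrix
    g⁻¹ = geometricSum q m

    upper-g⁻¹ : Upper 0 g⁻¹
    upper-g⁻¹ = upper-geometricSum m

    g*g⁻¹≋1 : g *ᴹ g⁻¹ ≋ 1ᴹ
    g*g⁻¹≋1 = 𝕄.trans (𝕄.*-congʳ (𝕄.sym 1-q≋g)) (proj₁ (nilpotent⇒1-q-invertible q m q-nilpotent))

    g⁻¹*g≋1 : g⁻¹ *ᴹ g ≋ 1ᴹ
    g⁻¹*g≋1 = 𝕄.trans (𝕄.*-congˡ (𝕄.sym 1-q≋g)) (proj₂ (nilpotent⇒1-q-invertible q m q-nilpotent))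

  Supported : ℕ → Matrix → Set ℓ
  Supported s A = ∀ i j → toℕ j ≢ toℕ i ℕ.+ s → A i j ≈ 0#

  supported⇒upper : ∀ {s A} → Supported s A → Upper s A
  supported⇒upper sA i j j<i+s = sA i j (ℕₚ.<⇒≢ j<i+s)

  supported-*ᴹ : ∀ {s t A B} → Supported s A → Supported t B → Supported (s ℕ.+ t) (A *ᴹ B)
  supported-*ᴹ {s} {t} {A} {B} sA sB i j j≢i+s+t = sum-≈ε _ term≈0
    where
    term≈0 : ∀ k → A i k * B k j ≈ 0#
    term≈0 k with toℕ k ℕ.≟ toℕ i ℕ.+ s
    ... | no  k≢i+s = trans (*-congʳ (sA i k k≢i+s)) (zeroˡ (B k j))
    ... | yes k≡i+s = trans (*-congˡ (sB k j j≢k+t)) (zeroʳ (A i k))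
      where
      j≢k+t : toℕ j ≢ toℕ k ℕ.+ t
      j≢k+t j≡k+t = j≢i+s+t (≡.trans j≡k+t (≡.trans (≡.cong (ℕ._+ t) k≡i+s) (ℕₚ.+-assoc (toℕ i) s t)))

  supported-commute : ∀ {s t A B} → Supported s A → Supported t B →
    (∀ {i l l′ j} → toℕ l ≡ toℕ i ℕ.+ s → toℕ j ≡ toℕ l ℕ.+ t → toℕ l′ ≡ toℕ i ℕ.+ t → toℕ j ≡ toℕ l′ ℕ.+ s →
       A i l * B l j ≈ B i l′ * A l′ j) →
    A *ᴹ B ≋ B *ᴹ A
  supported-commute {s} {t} {A} {B} sA sB entries-commute i j with toℕ j ℕ.≟ toℕ i ℕ.+ (s ℕ.+ t)
  ... | no  j≢i+s+t = trans (supported-*ᴹ sA sB i j j≢i+s+t)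
                        (sym (supported-*ᴹ sB sA i j (λ j≡i+t+s → j≢i+s+t (≡.trans j≡i+t+s (≡.cong (toℕ i ℕ.+_) (ℕₚ.+-comm t s))))))
  ... | yes j≡i+s+t = begin
    (A *ᴹ B) i j     ≈⟨ *ᴹ-entry (supported⇒upper sA) (supported⇒upper sB) l≡i+s j≡l+t ⟩
    A i l * B l j    ≈⟨ entries-commute l≡i+s j≡l+t l′≡i+t j≡l′+s ⟩
    B i l′ * A l′ j  ≈⟨ *ᴹ-entry (supported⇒upper sB) (supported⇒upper sA) l′≡i+t j≡l′+s ⟨
    (B *ᴹ A) i j     ∎
    where
    at : ∀ {a} → a ≤ toℕ j → Fin m
    at a≤j = fromℕ< (ℕₚ.≤-<-trans a≤j (toℕ<n j))
    i+≤j : ∀ {u} → u ≤ s ℕ.+ t → toℕ i ℕ.+ u ≤ toℕ j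
    i+≤j u≤s+t = ℕₚ.≤-trans (ℕₚ.+-monoʳ-≤ (toℕ i) u≤s+t) (ℕₚ.≤-reflexive (≡.sym j≡i+s+t))
    l l′ : Fin m
    l  = at (i+≤j (ℕₚ.m≤m+n s t))
    l′ = at (i+≤j (ℕₚ.m≤n+m t s))
    l≡i+s : toℕ l ≡ toℕ i ℕ.+ s
    l≡i+s = toℕ-fromℕ< _
    l′≡i+t : toℕ l′ ≡ toℕ i ℕ.+ t
    l′≡i+t = toℕ-fromℕ< _
    j≡l+t : toℕ j ≡ toℕ l ℕ.+ t
    j≡l+t = ≡.trans j≡i+s+t (≡.trans (≡.sym (ℕₚ.+-assoc (toℕ i) s t)) (≡.cong (ℕ._+ t) (≡.sym l≡i+s)))
    j≡l′+s : toℕ j ≡ toℕ l′ ℕ.+ s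
    j≡l′+s = ≡.trans j≡i+s+t (≡.trans (≡.cong (toℕ i ℕ.+_) (ℕₚ.+-comm s t))
               (≡.trans (≡.sym (ℕₚ.+-assoc (toℕ i) t s)) (≡.cong (ℕ._+ s) (≡.sym l′≡i+t))))

  superdiagonal : ℕ → Matrix → Matrix
  superdiagonal s A i j = if does (toℕ j ℕ.≟ toℕ i ℕ.+ s) then A i j else 0#

  superdiagonal-on : ∀ {s} A {i j} → toℕ j ≡ toℕ i ℕ.+ s → superdiagonal s A i j ≡ A i j
  superdiagonal-on {s} A {i} {j} j≡i+s rewrite dec-true (toℕ j ℕ.≟ toℕ i ℕ.+ s) j≡i+s = ≡.refl

  superdiagonal-off : ∀ {s} A {i j} → toℕ j ≢ toℕ i ℕ.+ s → superdiagonal s A i j ≡ 0#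
  superdiagonal-off {s} A {i} {j} j≢i+s rewrite dec-false (toℕ j ℕ.≟ toℕ i ℕ.+ s) j≢i+s = ≡.refl

  supported-superdiagonal : ∀ s A → Supported s (superdiagonal s A)
  supported-superdiagonal s A i j j≢i+s = reflexive (superdiagonal-off A j≢i+s)

  upper-superdiagonal-ᴹ : ∀ {s A} → Upper s A → Upper (suc s) (superdiagonal s A -ᴹ A)
  upper-superdiagonal-ᴹ {s} {A} uA i j j<i+1+s with toℕ j ℕ.≟ toℕ i ℕ.+ s
  ... | yes j≡i+s = trans (+-congʳ (reflexive (superdiagonal-on A j≡i+s))) (-‿inverseʳ (A i j))
  ... | no  j≢i+s = trans (+-cong (reflexive (superdiagonal-off A j≢i+s)) (-‿cong (uA i j j<i+s))) (-‿inverseʳ 0#)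
    where
    j<i+s : toℕ j < toℕ i ℕ.+ s
    j<i+s = ℕₚ.≤∧≢⇒< (ℕₚ.m<1+n⇒m≤n (ℕₚ.<-≤-trans j<i+1+s (ℕₚ.≤-reflexive (ℕₚ.+-suc (toℕ i) s)))) j≢i+s

  ≈1ᴹ⇒-1ᴹ≈0 : ∀ A i j → A i j ≈ 1ᴹ i j → (A -ᴹ 1ᴹ) i j ≈ 0#
  ≈1ᴹ⇒-1ᴹ≈0 A i j = x≈y⇒x∙y⁻¹≈ε

  -1ᴹ-off-diagonal : ∀ A {i j} → i ≢ j → (A -ᴹ 1ᴹ) i j ≈ A i j
  -1ᴹ-off-diagonal A {i} {j} i≢j =
    trans (+-congˡ (trans (-‿cong (reflexive (1ᴹ-off-diagonal i j i≢j))) ε⁻¹≈ε)) (+-identityʳ (A i j))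

  -1ᴹ≈0⇒≈1ᴹ : ∀ A i j → (A -ᴹ 1ᴹ) i j ≈ 0# → A i j ≈ 1ᴹ i j
  -1ᴹ≈0⇒≈1ᴹ A i j = x∙y⁻¹≈ε⇒x≈y (A i j) (1ᴹ i j)

module Lifting {c ℓ} (R : Ring c ℓ) (m : ℕ) where

  open Ring R
  open Matrices R m
  open Commutation matrixRing using (1+-commute)
  open import Algebra.Properties.Ring matrixRing using (x[y-z]≈xy-xz; [y-z]x≈yx-zx)
  open AbelianGroupProperties 𝕄.+-abelianGroup using (//-rightDividesˡ; ∙-cancelʳ; xyx⁻¹≈y; ⁻¹-anti-homo‿-)
  open AbelianGroupProperties +-abelianGroup using () renaming (∙-cancelʳ to +-cancelʳ)

  private
    module ≋-Reasoning = SetoidReasoning 𝕄.setoid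
    module ≈-Reasoning = SetoidReasoning setoid

    toℕ<⇒≢ : ∀ {i j : Fin m} → toℕ i < toℕ j → i ≢ j
    toℕ<⇒≢ i<j i≡j = ℕₚ.<-irrefl (≡.cong toℕ i≡j) i<j

    i<i+2 : ∀ a → a < a ℕ.+ 2
    i<i+2 a = ℕₚ.m<m+n a (ℕ.s≤s ℕ.z≤n)

  -- Equality of the images in U¹/U³ (the group B of the statement).
  AgreeOn[2,3] : Matrix → Matrix → Set ℓ
  AgreeOn[2,3] A B = ∀ i j → toℕ i ℕ.+ 2 ≤ toℕ j → toℕ j ≤ toℕ i ℕ.+ 3 → A i j ≈ B i j

  agree-at+2 : ∀ {A B} → AgreeOn[2,3] A B → ∀ {i j} → toℕ j ≡ toℕ i ℕ.+ 2 → A i j ≈ B i j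
  agree-at+2 agree {i} {j} j≡i+2 =
    agree i j (ℕₚ.≤-reflexive (≡.sym j≡i+2)) (ℕₚ.≤-trans (ℕₚ.≤-reflexive j≡i+2) (ℕₚ.+-monoʳ-≤ (toℕ i) (ℕₚ.n≤1+n 2)))

  agree-at+3 : ∀ {A B} → AgreeOn[2,3] A B → ∀ {i j} → toℕ j ≡ toℕ i ℕ.+ 3 → A i j ≈ B i j
  agree-at+3 agree {i} {j} j≡i+3 =
    agree i j (ℕₚ.≤-trans (ℕₚ.+-monoʳ-≤ (toℕ i) (ℕₚ.n≤1+n 2)) (ℕₚ.≤-reflexive (≡.sym j≡i+3))) (ℕₚ.≤-reflexive j≡i+3)

  module Construction
    (g x₀ y₀ b : Matrix)
    (g-unitriangular : Upper 1 (g -ᴹ 1ᴹ))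
    (x₀-unitriangular : Upper 2 (x₀ -ᴹ 1ᴹ))
    (g*x₀≋y₀*g : g *ᴹ x₀ ≋ y₀ *ᴹ g)
    (x₀≈b : AgreeOn[2,3] x₀ b)
    (y₀≈b : AgreeOn[2,3] y₀ b)
    (b-in-span : ∀ i j → toℕ j ≡ toℕ i ℕ.+ 3 → b i j ≈ 0#)
    where

    open UnitriangularInverse g g-unitriangular

    M X Y : Matrix
    M = g -ᴹ 1ᴹ
    X = x₀ -ᴹ 1ᴹ
    Y = y₀ -ᴹ 1ᴹ

    upper-g : Upper 0 g
    upper-g = upper-resp (//-rightDividesˡ 1ᴹ g) (upper-+ᴹ (upper-weaken ℕ.z≤n g-unitriangular) upper-1ᴹ)

    y₀≋g*x₀*g⁻¹ : y₀ ≋ g *ᴹ x₀ *ᴹ g⁻¹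
    y₀≋g*x₀*g⁻¹ = begin
      y₀                  ≈⟨ 𝕄.*-identityʳ y₀ ⟨
      y₀ *ᴹ 1ᴹ            ≈⟨ 𝕄.*-congˡ g*g⁻¹≋1 ⟨
      y₀ *ᴹ (g *ᴹ g⁻¹)    ≈⟨ 𝕄.*-assoc y₀ g g⁻¹ ⟨
      y₀ *ᴹ g *ᴹ g⁻¹      ≈⟨ 𝕄.*-congʳ g*x₀≋y₀*g ⟨
      g *ᴹ x₀ *ᴹ g⁻¹      ∎
      where
      open ≋-Reasoning

    Y≋g*X*g⁻¹ : Y ≋ g *ᴹ X *ᴹ g⁻¹
    Y≋g*X*g⁻¹ = begin
      y₀ -ᴹ 1ᴹ                            ≈⟨ 𝕄.+-cong y₀≋g*x₀*g⁻¹ (𝕄.-‿cong (𝕄.sym g*g⁻¹≋1)) ⟩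
      g *ᴹ x₀ *ᴹ g⁻¹ -ᴹ g *ᴹ g⁻¹          ≈⟨ [y-z]x≈yx-zx g⁻¹ (g *ᴹ x₀) g ⟨
      (g *ᴹ x₀ -ᴹ g) *ᴹ g⁻¹               ≈⟨ 𝕄.*-congʳ (𝕄.+-congˡ (𝕄.-‿cong (𝕄.*-identityʳ g))) ⟨
      (g *ᴹ x₀ -ᴹ g *ᴹ 1ᴹ) *ᴹ g⁻¹         ≈⟨ 𝕄.*-congʳ (x[y-z]≈xy-xz g x₀ 1ᴹ) ⟨
      g *ᴹ X *ᴹ g⁻¹                       ∎
      where
      open ≋-Reasoning

    upper-Y : Upper 2 Y
    upper-Y = upper-resp (𝕄.sym Y≋g*X*g⁻¹) (upper-*ᴹ (upper-*ᴹ upper-g x₀-unitriangular) upper-g⁻¹)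

    g*X≋Y*g : g *ᴹ X ≋ Y *ᴹ g
    g*X≋Y*g = ∙-cancelʳ g (g *ᴹ X) (Y *ᴹ g) (begin
      g *ᴹ X +ᴹ g               ≈⟨ 𝕄.+-congˡ (𝕄.*-identityʳ g) ⟨
      g *ᴹ X +ᴹ g *ᴹ 1ᴹ         ≈⟨ 𝕄.distribˡ g X 1ᴹ ⟨
      g *ᴹ (X +ᴹ 1ᴹ)            ≈⟨ 𝕄.*-congˡ (//-rightDividesˡ 1ᴹ x₀) ⟩
      g *ᴹ x₀                   ≈⟨ g*x₀≋y₀*g ⟩
      y₀ *ᴹ g                   ≈⟨ 𝕄.*-congʳ (//-rightDividesˡ 1ᴹ y₀) ⟨
      (Y +ᴹ 1ᴹ) *ᴹ g            ≈⟨ 𝕄.distribʳ g Y 1ᴹ ⟩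
      Y *ᴹ g +ᴹ 1ᴹ *ᴹ g         ≈⟨ 𝕄.+-congˡ (𝕄.*-identityˡ g) ⟩
      Y *ᴹ g +ᴹ g               ∎)
      where
      open ≋-Reasoning

    M*X+X≋Y*M+Y : M *ᴹ X +ᴹ X ≋ Y *ᴹ M +ᴹ Y
    M*X+X≋Y*M+Y = begin
      M *ᴹ X +ᴹ X               ≈⟨ 𝕄.+-congˡ (𝕄.*-identityˡ X) ⟨
      M *ᴹ X +ᴹ 1ᴹ *ᴹ X         ≈⟨ 𝕄.distribʳ X M 1ᴹ ⟨
      (M +ᴹ 1ᴹ) *ᴹ X            ≈⟨ 𝕄.*-congʳ (//-rightDividesˡ 1ᴹ g) ⟩
      g *ᴹ X                    ≈⟨ g*X≋Y*g ⟩
      Y *ᴹ g                    ≈⟨ 𝕄.*-congˡ (//-rightDividesˡ 1ᴹ g) ⟨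
      Y *ᴹ (M +ᴹ 1ᴹ)            ≈⟨ 𝕄.distribˡ Y M 1ᴹ ⟩
      Y *ᴹ M +ᴹ Y *ᴹ 1ᴹ         ≈⟨ 𝕄.+-congˡ (𝕄.*-identityʳ Y) ⟩
      Y *ᴹ M +ᴹ Y               ∎
      where
      open ≋-Reasoning

    invariance-at-i+3 : ∀ {i l l′ j} → toℕ l ≡ toℕ i ℕ.+ 1 → toℕ j ≡ toℕ l ℕ.+ 2 →
                        toℕ l′ ≡ toℕ i ℕ.+ 2 → toℕ j ≡ toℕ l′ ℕ.+ 1 →
                        M i l * b l j ≈ b i l′ * M l′ j
    invariance-at-i+3 {i} {l} {l′} {j} l≡i+1 j≡l+2 l′≡i+2 j≡l′+1 = begin
      M i l * b l j       ≈⟨ *-congˡ (trans (-1ᴹ-off-diagonal x₀ l≢j) (agree-at+2 x₀≈b j≡l+2)) ⟨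
      M i l * X l j       ≈⟨ *ᴹ-entry g-unitriangular x₀-unitriangular l≡i+1 j≡l+2 ⟨
      (M *ᴹ X) i j        ≈⟨ +-cancelʳ (X i j) _ _ (trans (M*X+X≋Y*M+Y i j) (+-congˡ (sym X≈Y))) ⟩
      (Y *ᴹ M) i j        ≈⟨ *ᴹ-entry upper-Y g-unitriangular l′≡i+2 j≡l′+1 ⟩
      Y i l′ * M l′ j     ≈⟨ *-congʳ (trans (-1ᴹ-off-diagonal y₀ i≢l′) (agree-at+2 y₀≈b l′≡i+2)) ⟩
      b i l′ * M l′ j     ∎
      where
      open ≈-Reasoning
      l≢j : l ≢ j
      l≢j = toℕ<⇒≢ (ℕₚ.<-≤-trans (i<i+2 (toℕ l)) (ℕₚ.≤-reflexive (≡.sym j≡l+2)))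
      i≢l′ : i ≢ l′
      i≢l′ = toℕ<⇒≢ (ℕₚ.<-≤-trans (i<i+2 (toℕ i)) (ℕₚ.≤-reflexive (≡.sym l′≡i+2)))
      j≡i+3 : toℕ j ≡ toℕ i ℕ.+ 3
      j≡i+3 = ≡.trans j≡l+2 (≡.trans (≡.cong (ℕ._+ 2) l≡i+1) (ℕₚ.+-assoc (toℕ i) 1 2))
      X≈Y : X i j ≈ Y i j
      X≈Y = +-congʳ (trans (agree-at+3 x₀≈b j≡i+3) (sym (agree-at+3 y₀≈b j≡i+3)))

    D N : Matrix
    D = superdiagonal 1 M
    N = superdiagonal 2 b

    D*N≋N*D : D *ᴹ N ≋ N *ᴹ D
    D*N≋N*D = supported-commute (supported-superdiagonal 1 M) (supported-superdiagonal 2 b)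
      λ l≡i+1 j≡l+2 l′≡i+2 j≡l′+1 →
        trans (*-cong (reflexive (superdiagonal-on M l≡i+1)) (reflexive (superdiagonal-on b j≡l+2)))
       (trans (invariance-at-i+3 l≡i+1 j≡l+2 l′≡i+2 j≡l′+1)
              (sym (*-cong (reflexive (superdiagonal-on b l′≡i+2)) (reflexive (superdiagonal-on M j≡l′+1)))))

    x k y h : Matrix
    x = 1ᴹ +ᴹ N
    k = 1ᴹ +ᴹ D
    y = g *ᴹ x *ᴹ g⁻¹
    h = k *ᴹ g⁻¹

    upper-x : Upper 2 (x -ᴹ 1ᴹ)
    upper-x = upper-resp (𝕄.sym (xyx⁻¹≈y 1ᴹ N)) (supported⇒upper (supported-superdiagonal 2 b))

    x≈b : AgreeOn[2,3] x b
    x≈b i j i+2≤j j≤i+3 = trans (+-congʳ (reflexive (1ᴹ-off-diagonal i j (toℕ<⇒≢ (ℕₚ.<-≤-trans (i<i+2 (toℕ i)) i+2≤j)))))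
                                (trans (+-identityˡ (N i j)) N≈b)
      where
      N≈b : N i j ≈ b i j
      N≈b with toℕ j ℕ.≟ toℕ i ℕ.+ 2
      ... | yes j≡i+2 = reflexive (superdiagonal-on b j≡i+2)
      ... | no  j≢i+2 = trans (reflexive (superdiagonal-off b j≢i+2)) (sym (b-in-span i j j≡i+3))
        where
        j≡i+3 : toℕ j ≡ toℕ i ℕ.+ 3
        j≡i+3 = ℕₚ.≤-antisym j≤i+3
          (ℕₚ.≤-trans (ℕₚ.≤-reflexive (ℕₚ.+-suc (toℕ i) 2)) (ℕₚ.≤∧≢⇒< i+2≤j (λ i+2≡j → j≢i+2 (≡.sym i+2≡j))))

    g*x≋y*g : g *ᴹ x ≋ y *ᴹ g
    g*x≋y*g = begin
      g *ᴹ x                    ≈⟨ 𝕄.*-identityʳ (g *ᴹ x) ⟨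
      g *ᴹ x *ᴹ 1ᴹ              ≈⟨ 𝕄.*-congˡ g⁻¹*g≋1 ⟨
      g *ᴹ x *ᴹ (g⁻¹ *ᴹ g)      ≈⟨ 𝕄.*-assoc (g *ᴹ x) g⁻¹ g ⟨
      y *ᴹ g                    ∎
      where
      open ≋-Reasoning

    k-g≋D-M : k -ᴹ g ≋ D -ᴹ M
    k-g≋D-M = begin
      1ᴹ +ᴹ D -ᴹ g       ≈⟨ 𝕄.+-congʳ (𝕄.+-comm 1ᴹ D) ⟩
      D +ᴹ 1ᴹ -ᴹ g       ≈⟨ 𝕄.+-assoc D 1ᴹ (-ᴹ g) ⟩
      D +ᴹ (1ᴹ -ᴹ g)     ≈⟨ 𝕄.+-congˡ (⁻¹-anti-homo‿- g 1ᴹ) ⟨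
      D -ᴹ M             ∎
      where
      open ≋-Reasoning

    h-1≋[D-M]*g⁻¹ : h -ᴹ 1ᴹ ≋ (D -ᴹ M) *ᴹ g⁻¹
    h-1≋[D-M]*g⁻¹ = begin
      k *ᴹ g⁻¹ -ᴹ 1ᴹ            ≈⟨ 𝕄.+-congˡ (𝕄.-‿cong g*g⁻¹≋1) ⟨
      k *ᴹ g⁻¹ -ᴹ g *ᴹ g⁻¹      ≈⟨ [y-z]x≈yx-zx g⁻¹ k g ⟨
      (k -ᴹ g) *ᴹ g⁻¹           ≈⟨ 𝕄.*-congʳ k-g≋D-M ⟩
      (D -ᴹ M) *ᴹ g⁻¹           ∎
      where
      open ≋-Reasoning

    upper-h : Upper 2 (h -ᴹ 1ᴹ)
    upper-h = upper-resp (𝕄.sym h-1≋[D-M]*g⁻¹) (upper-*ᴹ (upper-superdiagonal-ᴹ g-unitriangular) upper-g⁻¹)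

    h*y≋x*h : h *ᴹ y ≋ x *ᴹ h
    h*y≋x*h = begin
      k *ᴹ g⁻¹ *ᴹ (g *ᴹ x *ᴹ g⁻¹)     ≈⟨ 𝕄.*-assoc k g⁻¹ (g *ᴹ x *ᴹ g⁻¹) ⟩
      k *ᴹ (g⁻¹ *ᴹ (g *ᴹ x *ᴹ g⁻¹))   ≈⟨ 𝕄.*-congˡ (𝕄.*-assoc g⁻¹ (g *ᴹ x) g⁻¹) ⟨
      k *ᴹ (g⁻¹ *ᴹ (g *ᴹ x) *ᴹ g⁻¹)   ≈⟨ 𝕄.*-congˡ (𝕄.*-congʳ (𝕄.*-assoc g⁻¹ g x)) ⟨
      k *ᴹ (g⁻¹ *ᴹ g *ᴹ x *ᴹ g⁻¹)     ≈⟨ 𝕄.*-congˡ (𝕄.*-congʳ (𝕄.trans (𝕄.*-congʳ g⁻¹*g≋1) (𝕄.*-identityˡ x))) ⟩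
      k *ᴹ (x *ᴹ g⁻¹)                 ≈⟨ 𝕄.*-assoc k x g⁻¹ ⟨
      k *ᴹ x *ᴹ g⁻¹                   ≈⟨ 𝕄.*-congʳ (𝕄.sym (1+-commute (𝕄.sym (1+-commute D*N≋N*D)))) ⟩
      x *ᴹ k *ᴹ g⁻¹                   ≈⟨ 𝕄.*-assoc x k g⁻¹ ⟩
      x *ᴹ h                          ∎
      where
      open ≋-Reasoning

sumFin≡foldr : ∀ k (f : Fin k → ℤ) → sumFin k f ≡ foldr Int._+_ (+ 0) f
sumFin≡foldr zero    f = ≡.refl
sumFin≡foldr (suc k) f = ≡.cong (λ s → f fz Int.+ s) (sumFin≡foldr k (λ i → f (fs i)))

module ModularMatrices (p n : ℕ) where

  open Matrices (ℤ/ p) (suc n)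

  private
    ≡0⇒≡1ᴹ : ∀ a {i j} → toℕ i ≢ toℕ j → a ≡ + 0 [mod p ] → a ≡ 1ᴹ i j [mod p ]
    ≡0⇒≡1ᴹ a {i} {j} i≢j = ≡.subst (λ v → a ≡ v [mod p ]) (≡.sym (1ᴹ-off-diagonal i j (λ i≡j → i≢j (≡.cong toℕ i≡j))))

    ≡1ᴹ⇒≡0 : ∀ a {i j} → toℕ i ≢ toℕ j → a ≡ 1ᴹ i j [mod p ] → a ≡ + 0 [mod p ]
    ≡1ᴹ⇒≡0 a {i} {j} i≢j = ≡.subst (λ v → a ≡ v [mod p ]) (1ᴹ-off-diagonal i j (λ i≡j → i≢j (≡.cong toℕ i≡j)))

  ⊗≡*ᴹ : ∀ (A B : Mat n) i j → (A ⊗ B) i j ≡ (A *ᴹ B) i j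
  ⊗≡*ᴹ A B i j = sumFin≡foldr (suc n) (λ k → A i k Int.* B k j)

  ConjBy⇒≋ : ∀ g x y → ConjBy p n g x y → g *ᴹ x ≋ y *ᴹ g
  ConjBy⇒≋ g x y gx≡yg i j = ≡.subst₂ (λ u v → u ≡ v [mod p ]) (⊗≡*ᴹ g x i j) (⊗≡*ᴹ y g i j) (gx≡yg i j)

  ≋⇒ConjBy : ∀ g x y → g *ᴹ x ≋ y *ᴹ g → ConjBy p n g x y
  ≋⇒ConjBy g x y gx≋yg i j =
    ≡.subst₂ (λ u v → u ≡ v [mod p ]) (≡.sym (⊗≡*ᴹ g x i j)) (≡.sym (⊗≡*ᴹ y g i j)) (gx≋yg i j)

  InU⇒InUm₀ : ∀ A → InU p n A → InUm p n 0 A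
  InU⇒InUm₀ A A∈U = A∈U , λ i j i<j j≤i+0 →
    ⊥-elim (ℕₚ.<-irrefl ≡.refl (ℕₚ.<-≤-trans i<j (ℕₚ.≤-trans j≤i+0 (ℕₚ.≤-reflexive (ℕₚ.+-identityʳ (toℕ i))))))

  InUm⇒upper : ∀ {m} A → InUm p n m A → Upper (suc m) (A -ᴹ 1ᴹ)
  InUm⇒upper {m} A ((diagonal , below) , above) i j j<i+1+m = ≈1ᴹ⇒-1ᴹ≈0 A i j A≈1ᴹ
    where
    A≈1ᴹ : A i j ≡ 1ᴹ i j [mod p ]
    A≈1ᴹ with ℕₚ.<-cmp (toℕ j) (toℕ i)
    ... | tri< j<i _ _ = ≡0⇒≡1ᴹ (A i j) (ℕₚ.>⇒≢ j<i) (below i j j<i)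
    ... | tri> _ _ i<j = ≡0⇒≡1ᴹ (A i j) (ℕₚ.<⇒≢ i<j)
                           (above i j i<j (ℕₚ.m<1+n⇒m≤n (ℕₚ.<-≤-trans j<i+1+m (ℕₚ.≤-reflexive (ℕₚ.+-suc (toℕ i) m)))))
    ... | tri≈ _ j≡i _ with toℕ-injective j≡i
    ...   | ≡.refl = ≡.subst (λ v → A i i ≡ v [mod p ]) (≡.sym (1ᴹ-diagonal i)) (diagonal i)

  upper⇒InUm : ∀ {m} A → Upper (suc m) (A -ᴹ 1ᴹ) → InUm p n m A
  upper⇒InUm {m} A upper = (diagonal , below) , above
    where
    A≈1ᴹ : ∀ i j → toℕ j < toℕ i ℕ.+ suc m → A i j ≡ 1ᴹ i j [mod p ]
    A≈1ᴹ i j j<i+1+m = -1ᴹ≈0⇒≈1ᴹ A i j (upper i j j<i+1+m)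
    diagonal : ∀ i → A i i ≡ + 1 [mod p ]
    diagonal i = ≡.subst (λ v → A i i ≡ v [mod p ]) (1ᴹ-diagonal i) (A≈1ᴹ i i (ℕₚ.m<m+n (toℕ i) (ℕ.s≤s ℕ.z≤n)))
    below : ∀ i j → toℕ j < toℕ i → A i j ≡ + 0 [mod p ]
    below i j j<i = ≡1ᴹ⇒≡0 (A i j) (ℕₚ.>⇒≢ j<i) (A≈1ᴹ i j (ℕₚ.<-≤-trans j<i (ℕₚ.m≤m+n (toℕ i) (suc m))))
    above : ∀ i j → toℕ i < toℕ j → toℕ j ≤ toℕ i ℕ.+ m → A i j ≡ + 0 [mod p ]
    above i j i<j j≤i+m = ≡1ᴹ⇒≡0 (A i j) (ℕₚ.<⇒≢ i<j) (A≈1ᴹ i j (ℕₚ.≤-<-trans j≤i+m (ℕₚ.+-monoʳ-< (toℕ i) (ℕₚ.n<1+n m))))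

lemma4p11 : (p : ℕ) → Prime p → (n : ℕ) → 3 ≤ n →
    (g : Mat n) → InU p n g →
    (b : Mat n) → InSpan2 p n b → BFixed p n g b →
    Σ (Mat n) λ x → Lifts p n x b × ClassFixed p n g x
lemma4p11 p _ n _ g g∈U b b∈span (x₀ , y₀ , (x₀∈U¹ , x₀≈b) , g*x₀≡y₀*g , y₀≈b) =
  x , (upper⇒InUm x upper-x , x≈b) ,
  y , ≋⇒ConjBy g x y g*x≋y*g ,
  h , upper⇒InUm h upper-h , ≋⇒ConjBy h y x h*y≋x*h
  where
  open ModularMatrices p n
  open Lifting.Construction (ℤ/ p) (suc n) g x₀ y₀ b
    (InUm⇒upper g (InU⇒InUm₀ g g∈U)) (InUm⇒upper x₀ x₀∈U¹) (ConjBy⇒≋ g x₀ y₀ g*x₀≡y₀*g) x₀≈b y₀≈b b∈span
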